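{- Let $r\ge 3$ and $k\ge 0$ be integers, and let $K_{1,r}$ be the star graph. For every labelling $\eta$ of the vertices of $K_{1,r}$ (a bijection $V(K_{1,r})\to[r+1]$), the graph $G(K_{1,r};k;\eta)$ produced by the Bruck–Cypher–Ho construction is, up to isomorphism, independent of $\eta$. Moreover, it is isomorphic to $K_{k+1} * \overline{K}_r$.
   Context: Graphs are finite, undirected, without loops or multiple edges. $[n]=\{1,\dots,n\}$. A star graph is $K_{1,r}$ with $r\ge 3$. The Bruck–Cypher–Ho construction: given a graph $H$ of order $n$, a non-negative integer $k$, and a labelling $\eta$ of $V(H)$ by distinct elements of $[n]$, form the graph $G(H;k;\eta)$ with vertex set $[n+k]$ (the labels of $H$'s vertices plus $k$ new vertices labelled $n+1,\dots,n+k$), where for every edge $ij$ of $H$ (with labels $i,j$) each vertex of $\{i,\dots,i+k\}$ is joined to each distinct vertex of $\{j,\dots,j+k\}$, and these are all the edges. For graphs $G_1,G_2$ on disjoint vertex sets, the conjunction $G_1*G_2$ has vertex set $V(G_1)\cup V(G_2)$ and edge set $E(G_1)\cup E(G_2)$ together with all edges between $V(G_1)$ and $V(G_2)$. $\overline{K}_r$ denotes the edgeless graph on $r$ vertices. -}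

module Defs where

open import Level using (0ℓ)
open import Data.Nat using (ℕ; suc; _+_; _≤_)
open import Data.Fin using (Fin; zero; toℕ)
open import Data.Sum using (_⊎_; inj₁; inj₂)
open import Data.Product using (_×_; ∃₂)
open import Data.Unit using (⊤)
open import Data.Empty using (⊥)
open import Relation.Nullary using (¬_)
open import Relation.Binary.PropositionalEquality using (_≡_; _≢_)
open import Function.Bundles using (_↔_; _⇔_; Inverse)

-- A graph: a vertex type with an adjacency relation.
-- (All graphs built below are symmetric and loopless.)
record Graph : Set₁ where
  field
    V   : Set
    Adj : V → V → Set
open Graph public

record _≅_ (G H : Graph) : Set where
  field
    bij  : V G ↔ V H
    pres : ∀ x y → Adj G x y ⇔ Adj H (Inverse.to bij x) (Inverse.to bij y)

K : ℕ → Graph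
K m = record { V = Fin m ; Adj = λ x y → x ≢ y }

Kbar : ℕ → Graph
Kbar m = record { V = Fin m ; Adj = λ _ _ → ⊥ }

_*_ : Graph → Graph → Graph
G₁ * G₂ = record { V = V G₁ ⊎ V G₂ ; Adj = adj }
  where
  adj : V G₁ ⊎ V G₂ → V G₁ ⊎ V G₂ → Set
  adj (inj₁ a) (inj₁ b) = Adj G₁ a b
  adj (inj₂ a) (inj₂ b) = Adj G₂ a b
  adj (inj₁ _) (inj₂ _) = ⊤
  adj (inj₂ _) (inj₁ _) = ⊤

Star : ℕ → Graph
Star r = record { V = Fin (suc r) ; Adj = λ x y → (x ≡ zero × y ≢ zero) ⊎ (y ≡ zero × x ≢ zero) }

-- Labels [n] are encoded 0-based
-- as Fin n; the new vertices n+1..n+k are Fin (n + k) elements n..n+k-1.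
-- x,y are adjacent iff x ≠ y and for some edge uv of H, x ∈ {η u,…,η u + k}
-- and y ∈ {η v,…,η v + k}.
BCH : (H : Graph) (n : ℕ) → (V H ↔ Fin n) → (k : ℕ) → Graph
BCH H n η k = record { V = Fin (n + k) ; Adj = adj }
  where
  lab : V H → ℕ
  lab u = toℕ (Inverse.to η u)
  adj : Fin (n + k) → Fin (n + k) → Set
  adj x y = x ≢ y × ∃₂ λ u v → Adj H u v
              × (lab u ≤ toℕ x × toℕ x ≤ lab u + k)
              × (lab v ≤ toℕ y × toℕ y ≤ lab v + k)

-- The centre label a of the star spans the block C = [a, a + k] of the labels 0, …, r + k,
-- and every edge of G(K₁,ᵣ; k; η) joins a vertex of C to a vertex of a leaf block. Each of the
-- r vertices outside C lies in a leaf block (that of its own label if it is below a, that of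
-- its label minus k if it is above a + k), and so does every vertex of C except one end, since
-- the block of the leaf a − 1 (or 1 if a = 0) covers the rest of C. Hence two distinct
-- vertices are adjacent exactly when one of them lies in C: C is a clique of size k + 1 joined
-- to an independent set of size r, whatever η is.
module Submission where

open import Defs
open import Data.Nat using (ℕ; suc; _≤_)
open import Data.Fin using (Fin)
open import Data.Product using (_×_)
open import Function.Bundles using (_↔_)

open import Data.Nat using (zero; _+_; _∸_; _<_; z≤n; s≤s; s≤s⁻¹)
open import Data.Nat.Properties
  using (_≟_; ≤-refl; ≤-trans; <⇒≤; <⇒≱; m≤m+n; m≤n+m∸n; m∸n≤m; m∸n+n≡m; m+n∸n≡m; m+[n∸m]≡n;
         m∸n≡0⇒m≤n; m∸n≢0⇒n<m; 1+n≢0; m≤n⇒m≤1+n; n≢0⇒n>0; ∸-monoˡ-≤; +-monoʳ-≤; +-monoʳ-<; +-comm;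
         +-assoc; +-suc)
open import Data.Fin using (zero; toℕ; fromℕ<; splitAt; cast)
open import Data.Fin.Properties
  using (+↔⊎; toℕ<n; toℕ-↑ˡ; toℕ-↑ʳ; toℕ-cast; toℕ-fromℕ<; toℕ-injective; splitAt⁻¹-↑ˡ; splitAt⁻¹-↑ʳ)
open import Data.Fin.Permutation using (cast-id)
open import Data.Product using (∃-syntax; _,_; map₂)
open import Data.Product.Function.NonDependent.Propositional using (_×-⇔_)
open import Data.Sum using (_⊎_; inj₁; inj₂; map; swap)
open import Data.Sum.Properties using (inj₁-injective)
open import Data.Sum.Function.Propositional using (_⊎-↔_; _⊎-⇔_)
open import Data.Unit using (⊤; tt)
open import Data.Empty using (⊥; ⊥-elim)
open import Function.Base using (_∘_)
open import Function.Bundles using (_⇔_; Inverse; Injection; mk↔ₛ′; mk⇔)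
open import Function.Construct.Composition using () renaming (equivalence to ⇔-trans)
open import Function.Construct.Identity using (⇔-id)
open import Function.Construct.Symmetry using (⇔-sym)
open import Function.Properties.Inverse using (↔-refl; ↔-sym; ↔-trans; ↔⇒↣)
open import Relation.Nullary using (yes; no)
open import Relation.Binary.PropositionalEquality
  using (_≡_; _≢_; refl; sym; trans; cong; subst; subst₂; module ≡-Reasoning)

private variable
  A B C : Set

≅-sym : ∀ {G H} → G ≅ H → H ≅ G
≅-sym {G} {H} G≅H = record { bij = ↔-sym bij ; pres = pres′ }
  where
  open _≅_ G≅H
  open Inverse bij using (from; strictlyInverseˡ)
  pres′ : ∀ x y → Adj H x y ⇔ Adj G (from x) (from y)
  pres′ x y = ⇔-sym (subst₂ (λ u v → Adj G (from x) (from y) ⇔ Adj H u v)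
                            (strictlyInverseˡ x) (strictlyInverseˡ y) (pres (from x) (from y)))

≅-trans : ∀ {G H L} → G ≅ H → H ≅ L → G ≅ L
≅-trans G≅H H≅L = record
  { bij  = ↔-trans (_≅_.bij G≅H) (_≅_.bij H≅L)
  ; pres = λ x y → ⇔-trans (_≅_.pres G≅H x y) (_≅_.pres H≅L _ _)
  }

IsInj₁ : A ⊎ B → Set
IsInj₁ (inj₁ _) = ⊤
IsInj₁ (inj₂ _) = ⊥

IsInj₁-map : ∀ {A′ B′ : Set} {f : A → A′} {g : B → B′} (s : A ⊎ B) →
             IsInj₁ (map f g s) ⇔ IsInj₁ s
IsInj₁-map (inj₁ _) = ⇔-id ⊤
IsInj₁-map (inj₂ _) = ⇔-id ⊥

≢-cong : (φ : A ↔ B) {x y : A} → x ≢ y ⇔ Inverse.to φ x ≢ Inverse.to φ y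
≢-cong φ = mk⇔ (λ x≢y → x≢y ∘ Injection.injective (↔⇒↣ φ)) (λ φx≢φy → φx≢φy ∘ cong (Inverse.to φ))

K*Kbar-adj : ∀ {m n} (s t : Fin m ⊎ Fin n) →
             Adj (K m * Kbar n) s t ⇔ (s ≢ t × (IsInj₁ s ⊎ IsInj₁ t))
K*Kbar-adj (inj₁ i) (inj₁ j) =
  mk⇔ (λ i≢j → i≢j ∘ inj₁-injective , inj₁ tt) (λ (s≢t , _) → s≢t ∘ cong inj₁)
K*Kbar-adj (inj₁ i) (inj₂ j) = mk⇔ (λ _ → (λ ()) , inj₁ tt) (λ _ → tt)
K*Kbar-adj (inj₂ i) (inj₁ j) = mk⇔ (λ _ → (λ ()) , inj₂ tt) (λ _ → tt)
K*Kbar-adj (inj₂ i) (inj₂ j) = mk⇔ (λ ()) λ { (_ , inj₁ ()) ; (_ , inj₂ ()) }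

≅-K*Kbar : ∀ {m n} (G : Graph) (φ : V G ↔ (Fin m ⊎ Fin n)) →
           (∀ x y → Adj G x y ⇔ (x ≢ y × (IsInj₁ (Inverse.to φ x) ⊎ IsInj₁ (Inverse.to φ y)))) →
           G ≅ (K m * Kbar n)
≅-K*Kbar G φ adj⇔ = record { bij = φ ; pres = pres }
  where
  pres : ∀ x y → Adj G x y ⇔ Adj (K _ * Kbar _) (Inverse.to φ x) (Inverse.to φ y)
  pres x y = ⇔-trans (adj⇔ x y)
               (⇔-trans (≢-cong φ ×-⇔ ⇔-id _) (⇔-sym (K*Kbar-adj (Inverse.to φ x) (Inverse.to φ y))))

⊎-swapˡ : A ⊎ B ⊎ C → B ⊎ A ⊎ C
⊎-swapˡ (inj₁ x)        = inj₂ (inj₁ x)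
⊎-swapˡ (inj₂ (inj₁ y)) = inj₁ y
⊎-swapˡ (inj₂ (inj₂ z)) = inj₂ (inj₂ z)

⊎-swapˡ-involutive : (s : A ⊎ B ⊎ C) → ⊎-swapˡ (⊎-swapˡ s) ≡ s
⊎-swapˡ-involutive (inj₁ x)        = refl
⊎-swapˡ-involutive (inj₂ (inj₁ y)) = refl
⊎-swapˡ-involutive (inj₂ (inj₂ z)) = refl

⊎-swapˡ↔ : (A ⊎ B ⊎ C) ↔ (B ⊎ A ⊎ C)
⊎-swapˡ↔ = mk↔ₛ′ ⊎-swapˡ ⊎-swapˡ ⊎-swapˡ-involutive ⊎-swapˡ-involutive

toℕ-splitAt-inj₁ : ∀ m {n} {i : Fin (m + n)} {j} → splitAt m i ≡ inj₁ j → toℕ i ≡ toℕ j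
toℕ-splitAt-inj₁ m {n} {j = j} e = trans (sym (cong toℕ (splitAt⁻¹-↑ˡ e))) (toℕ-↑ˡ j n)

toℕ-splitAt-inj₂ : ∀ m {n} {i : Fin (m + n)} {j} → splitAt m i ≡ inj₂ j → toℕ i ≡ m + toℕ j
toℕ-splitAt-inj₂ m {j = j} e = trans (sym (cong toℕ (splitAt⁻¹-↑ʳ e))) (toℕ-↑ʳ m j)

Fin⊎-extractMiddle : ∀ a b c → (Fin a ⊎ Fin (b + c)) ↔ (Fin b ⊎ Fin (a + c))
Fin⊎-extractMiddle a b c =
  ↔-trans (↔-refl ⊎-↔ +↔⊎ {b}) (↔-trans ⊎-swapˡ↔ (↔-refl ⊎-↔ ↔-sym (+↔⊎ {a})))

Fin-extractMiddle : ∀ a b c → Fin (a + (b + c)) ↔ (Fin b ⊎ Fin (a + c))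
Fin-extractMiddle a b c = ↔-trans (+↔⊎ {a}) (Fin⊎-extractMiddle a b c)

Fin-extractMiddle-inj₁ : ∀ a b c (x : Fin (a + (b + c))) →
  IsInj₁ (Inverse.to (Fin-extractMiddle a b c) x) ⇔ (a ≤ toℕ x × toℕ x < a + b)
Fin-extractMiddle-inj₁ a b c x with splitAt a x in e
... | inj₁ i = mk⇔ (λ ()) (λ (a≤x , _) → <⇒≱ x<a a≤x)
  where
  x<a : toℕ x < a
  x<a = subst (_< a) (sym (toℕ-splitAt-inj₁ a e)) (toℕ<n i)
... | inj₂ y with splitAt b y in e′
...   | inj₁ j = mk⇔ (λ _ → a≤x , x<a+b) (λ _ → tt)
  where
  x≡a+y : toℕ x ≡ a + toℕ y
  x≡a+y = toℕ-splitAt-inj₂ a e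
  a≤x : a ≤ toℕ x
  a≤x = subst (a ≤_) (sym x≡a+y) (m≤m+n a (toℕ y))
  x<a+b : toℕ x < a + b
  x<a+b = subst (_< a + b) (sym x≡a+y)
                (+-monoʳ-< a (subst (_< b) (sym (toℕ-splitAt-inj₁ b e′)) (toℕ<n j)))
...   | inj₂ l = mk⇔ (λ ()) (λ (_ , x<a+b) → <⇒≱ x<a+b a+b≤x)
  where
  a+b≤x : a + b ≤ toℕ x
  a+b≤x = subst (a + b ≤_)
                (sym (trans (toℕ-splitAt-inj₂ a e) (cong (a +_) (toℕ-splitAt-inj₂ b e′))))
                (+-monoʳ-≤ a (m≤m+n b (toℕ l)))

_∈[_,_] : ℕ → ℕ → ℕ → Set
t ∈[ lo , hi ] = lo ≤ t × t ≤ hi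

<+suc⇔∈[] : ∀ a k t → (a ≤ t × t < a + suc k) ⇔ t ∈[ a , a + k ]
<+suc⇔∈[] a k t = mk⇔ (map₂ (λ t<a+1+k → s≤s⁻¹ (subst (t <_) (+-suc a k) t<a+1+k)))
                      (map₂ (λ t≤a+k → subst (t <_) (sym (+-suc a k)) (s≤s t≤a+k)))

-- The end of the centre block [a, a + k] missed by the block of the label next to a
-- (1 if a = 0, a − 1 otherwise).
farEnd : ℕ → ℕ → ℕ
farEnd zero    k = 0
farEnd (suc a) k = suc a + k

farEnd-∈ : ∀ a k → farEnd a k ∈[ a , a + k ]
farEnd-∈ zero    k = z≤n , z≤n
farEnd-∈ (suc a) k = m≤m+n (suc a) k , ≤-refl

-- The label t ∸ k works unless it is a itself, which for a > 0 forces t = a + k.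
leafLabel-∈ : ∀ {r} a k t → 1 ≤ r → t ≤ r + k → t ≢ farEnd a k →
               ∃[ b ] b ≤ r × b ≢ a × t ∈[ b , b + k ]
leafLabel-∈ {r} a k t 1≤r t≤r+k t≢end with t ∸ k ≟ a
... | no t∸k≢a = t ∸ k , t∸k≤r , t∸k≢a , m∸n≤m t k , t≤t∸k+k
  where
  t∸k≤r : t ∸ k ≤ r
  t∸k≤r = subst (t ∸ k ≤_) (m+n∸n≡m r k) (∸-monoˡ-≤ k t≤r+k)
  t≤t∸k+k : t ≤ t ∸ k + k
  t≤t∸k+k = subst (t ≤_) (+-comm k (t ∸ k)) (m≤n+m∸n t k)
leafLabel-∈ zero k t 1≤r _ t≢0 | yes t∸k≡0 =
  1 , 1≤r , (λ ()) , n≢0⇒n>0 t≢0 , m≤n⇒m≤1+n (m∸n≡0⇒m≤n t∸k≡0)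
leafLabel-∈ (suc a) k t _ _ t≢end | yes t∸k≡1+a = ⊥-elim (t≢end t≡end)
  where
  k≤t : k ≤ t
  k≤t = <⇒≤ (m∸n≢0⇒n<m (λ t∸k≡0 → 1+n≢0 (trans (sym t∸k≡1+a) t∸k≡0)))
  t≡end : t ≡ suc a + k
  t≡end = trans (sym (m∸n+n≡m k≤t)) (cong (_+ k) t∸k≡1+a)

module StarBCH {r : ℕ} (1≤r : 1 ≤ r) (k : ℕ) (η : Fin (suc r) ↔ Fin (suc r)) where

  G : Graph
  G = BCH (Star r) (suc r) η k

  lab : Fin (suc r) → ℕ
  lab u = toℕ (Inverse.to η u)

  centre : ℕ
  centre = lab zero

  centre≤r : centre ≤ r
  centre≤r = s≤s⁻¹ (toℕ<n (Inverse.to η zero))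

  InCentreBlock : Fin (suc r + k) → Set
  InCentreBlock x = toℕ x ∈[ centre , centre + k ]

  leaf-∈ : ∀ x → toℕ x ≢ farEnd centre k → ∃[ v ] v ≢ zero × toℕ x ∈[ lab v , lab v + k ]
  leaf-∈ x x≢end with leafLabel-∈ centre k (toℕ x) 1≤r (s≤s⁻¹ (toℕ<n x)) x≢end
  ... | b , b≤r , b≢centre , x∈b = v , v≢0 , subst (λ c → toℕ x ∈[ c , c + k ]) (sym lab-v) x∈b
    where
    v : Fin (suc r)
    v = Inverse.from η (fromℕ< (s≤s b≤r))
    lab-v : lab v ≡ b
    lab-v = trans (cong toℕ (Inverse.strictlyInverseˡ η _)) (toℕ-fromℕ< _)
    v≢0 : v ≢ zero
    v≢0 v≡0 = b≢centre (trans (sym lab-v) (cong lab v≡0))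

  adj-sym : ∀ {x y} → Adj G x y → Adj G y x
  adj-sym (x≢y , u , v , uv , x∈u , y∈v) = x≢y ∘ sym , v , u , swap uv , y∈v , x∈u

  adj-centre : ∀ {x y} → x ≢ y → InCentreBlock x → Adj G x y
  adj-centre {x} {y} x≢y x∈c with toℕ y ≟ farEnd centre k
  ... | no y≢end with leaf-∈ y y≢end
  ...   | v , v≢0 , y∈v = x≢y , zero , v , inj₁ (refl , v≢0) , x∈c , y∈v
  adj-centre {x} {y} x≢y x∈c | yes y≡end
    with leaf-∈ x (λ x≡end → x≢y (toℕ-injective (trans x≡end (sym y≡end))))
  ...   | v , v≢0 , x∈v = x≢y , v , zero , inj₂ (refl , v≢0) , x∈v , y∈c
    where
    y∈c : InCentreBlock y
    y∈c = subst (_∈[ centre , centre + k ]) (sym y≡end) (farEnd-∈ centre k)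

  adj⇔ : ∀ x y → Adj G x y ⇔ (x ≢ y × (InCentreBlock x ⊎ InCentreBlock y))
  adj⇔ x y = mk⇔ centre-edge adj
    where
    centre-edge : Adj G x y → x ≢ y × (InCentreBlock x ⊎ InCentreBlock y)
    centre-edge (x≢y , _ , _ , inj₁ (refl , _) , x∈c , _) = x≢y , inj₁ x∈c
    centre-edge (x≢y , _ , _ , inj₂ (refl , _) , _ , y∈c) = x≢y , inj₂ y∈c
    adj : x ≢ y × (InCentreBlock x ⊎ InCentreBlock y) → Adj G x y
    adj (x≢y , inj₁ x∈c) = adj-centre x≢y x∈c
    adj (x≢y , inj₂ y∈c) = adj-sym (adj-centre (x≢y ∘ sym) y∈c)

  length-split : suc r + k ≡ centre + (suc k + (r ∸ centre))
  length-split = begin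
    suc r + k                          ≡⟨ +-comm (suc r) k ⟩
    k + suc r                          ≡⟨ +-suc k r ⟩
    suc k + r                          ≡⟨ cong (suc k +_) (sym (m+[n∸m]≡n centre≤r)) ⟩
    suc k + (centre + (r ∸ centre))    ≡⟨ sym (+-assoc (suc k) centre _) ⟩
    (suc k + centre) + (r ∸ centre)    ≡⟨ cong (_+ (r ∸ centre)) (+-comm (suc k) centre) ⟩
    (centre + suc k) + (r ∸ centre)    ≡⟨ +-assoc centre (suc k) _ ⟩
    centre + (suc k + (r ∸ centre))    ∎
    where open ≡-Reasoning

  split : Fin (suc r + k) ↔ (Fin (suc k) ⊎ Fin r)
  split = ↔-trans (cast-id length-split)
            (↔-trans (Fin-extractMiddle centre (suc k) (r ∸ centre))
                     (↔-refl ⊎-↔ cast-id (m+[n∸m]≡n centre≤r)))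

  split-inj₁ : ∀ x → IsInj₁ (Inverse.to split x) ⇔ InCentreBlock x
  split-inj₁ x =
    ⇔-trans (IsInj₁-map (Inverse.to (Fin-extractMiddle centre (suc k) (r ∸ centre)) x′))
      (⇔-trans (Fin-extractMiddle-inj₁ centre (suc k) (r ∸ centre) x′)
        (subst (λ t → (centre ≤ t × t < centre + suc k) ⇔ InCentreBlock x)
               (sym (toℕ-cast length-split x)) (<+suc⇔∈[] centre k (toℕ x))))
    where
    x′ : Fin (centre + (suc k + (r ∸ centre)))
    x′ = cast length-split x

  BCH-star≅K*Kbar : G ≅ (K (suc k) * Kbar r)
  BCH-star≅K*Kbar = ≅-K*Kbar G split λ x y →
    ⇔-trans (adj⇔ x y) (⇔-id _ ×-⇔ (⇔-sym (split-inj₁ x) ⊎-⇔ ⇔-sym (split-inj₁ y)))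

lemma1 : ∀ (r : ℕ) → 3 ≤ r → ∀ (k : ℕ) → (η : V (Star r) ↔ Fin (suc r))
       → ((η′ : V (Star r) ↔ Fin (suc r)) → BCH (Star r) (suc r) η k ≅ BCH (Star r) (suc r) η′ k)
         × (BCH (Star r) (suc r) η k ≅ (K (suc k) * Kbar r))
lemma1 r 3≤r k η = (λ η′ → ≅-trans (iso η) (≅-sym (iso η′))) , iso η
  where
  iso : ∀ η → BCH (Star r) (suc r) η k ≅ (K (suc k) * Kbar r)
  iso = StarBCH.BCH-star≅K*Kbar (≤-trans (s≤s z≤n) 3≤r) k
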